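{- Let $G$ be a $2d$-regular graph on $m$ vertices and $n\ge 3$, and suppose the strong product $G\boxtimes C_n$ is closed distance magic. Then $n\equiv 1\pmod 2$ and $m\equiv 1\pmod 2$. Moreover, $n\equiv 3\pmod 6$ or $-1\in Sp(G)$.
   Context: $Sp(G)$ is the set of eigenvalues of the adjacency matrix of $G$; $C_n$ is the cycle on $n$ vertices. The strong product $G\boxtimes H$ has vertex set $V(G)\times V(H)$, and $(g,h)$, $(g',h')$ are adjacent iff either $g=g'$ and $hh'\in E(H)$, or $h=h'$ and $gg'\in E(G)$, or $gg'\in E(G)$ and $hh'\in E(H)$. A graph on $N$ vertices is closed distance magic if there is a bijection $\ell\colon V\to\{1,\dots,N\}$ and a positive integer $k'$ such that the sum of $\ell$ over the closed neighborhood of every vertex equals $k'$. -}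

module Defs where

open import Data.Nat as ℕ using (ℕ; zero; suc)
open import Data.Fin using (Fin; toℕ) renaming (zero to fz; suc to fs)
open import Data.Fin.Properties using () renaming (_≟_ to _≟F_)
open import Data.Bool using (Bool; true; false; if_then_else_; _∨_; _∧_; T)
open import Data.Product using (Σ; ∃; _×_; _,_)
open import Relation.Nullary using (¬_)
open import Relation.Nullary.Decidable using (⌊_⌋)
open import Relation.Binary.PropositionalEquality using (_≡_)
open import Function.Definitions using (Injective; Surjective)
open import Data.Rational as ℚ using (ℚ; 0ℚ; 1ℚ)

sumℕ : (n : ℕ) → (Fin n → ℕ) → ℕ
sumℕ zero    f = 0
sumℕ (suc n) f = f fz ℕ.+ sumℕ n (λ i → f (fs i))

sumℚ : (n : ℕ) → (Fin n → ℚ) → ℚ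
sumℚ zero    f = 0ℚ
sumℚ (suc n) f = f fz ℚ.+ sumℚ n (λ i → f (fs i))

_==_ : {n : ℕ} → Fin n → Fin n → Bool
i == j = ⌊ i ≟F j ⌋

record Graph (m : ℕ) : Set where
  field
    adj   : Fin m → Fin m → Bool
    sym   : ∀ u v → adj u v ≡ adj v u
    irrefl : ∀ v → adj v v ≡ false
open Graph public

degree : {m : ℕ} → Graph m → Fin m → ℕ
degree {m} G v = sumℕ m (λ u → if adj G v u then 1 else 0)

Regular : {m : ℕ} → Graph m → ℕ → Set
Regular G k = ∀ v → degree G v ≡ k

cycleAdj : (n : ℕ) → Fin n → Fin n → Bool
cycleAdj n i j =
  ⌊ toℕ j ℕ.≟ ((suc (toℕ i)) ℕ.% (suc (ℕ.pred n))) ⌋ ∨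
  ⌊ toℕ i ℕ.≟ ((suc (toℕ j)) ℕ.% (suc (ℕ.pred n))) ⌋
-- (for n ≥ 1, suc (pred n) = n, so this is reduction mod n)

strongAdj : {m : ℕ} → Graph m → (n : ℕ) → Fin m × Fin n → Fin m × Fin n → Bool
strongAdj G n (g , h) (g' , h') =
  ((g == g') ∧ cycleAdj n h h') ∨
  ((h == h') ∧ adj G g g') ∨
  (adj G g g' ∧ cycleAdj n h h')

-- Closed distance magic for the strong product G ⊠ C_n (N = m * n vertices):
-- a bijection ℓ : V → {1,…,N} (encoded as Fin N with value toℕ + 1) and a
-- positive k' such that every closed neighbourhood has label sum k'.
ClosedDistanceMagicStrong : {m : ℕ} → Graph m → (n : ℕ) → Set
ClosedDistanceMagicStrong {m} G n =
  Σ (Fin m × Fin n → Fin (m ℕ.* n)) λ ℓ →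
    Injective _≡_ _≡_ ℓ × Surjective _≡_ _≡_ ℓ ×
    Σ ℕ λ k' → (0 ℕ.< k') ×
      (∀ (v : Fin m × Fin n) →
        sumℕ m (λ g → sumℕ n (λ h →
          let u = (g , h) in
          if (Data.Product.proj₁ u == Data.Product.proj₁ v ∧ Data.Product.proj₂ u == Data.Product.proj₂ v)
             ∨ strongAdj G n v u
          then suc (toℕ (ℓ u)) else 0)) ≡ k')

adjMatrix : {m : ℕ} → Graph m → Fin m → Fin m → ℚ
adjMatrix G i j = if adj G i j then 1ℚ else 0ℚ

IsEigenvalue : {m : ℕ} → (Fin m → Fin m → ℚ) → ℚ → Set
IsEigenvalue {m} A λ′ =
  Σ (Fin m → ℚ) λ x → (∃ λ i → ¬ (x i ≡ 0ℚ)) ×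
    (∀ i → sumℚ m (λ j → A i j ℚ.* x j) ≡ λ′ ℚ.* x i)

MinusOneInSpectrum : {m : ℕ} → Graph m → Set
MinusOneInSpectrum G = IsEigenvalue (adjMatrix G) (ℚ.- 1ℚ)

module Submission where

-- The closed neighbourhood of (g, h) in G ⊠ C_n is N[g] × N[h]. Writing Y g h for the sum of the labels
-- on N[g] × {h}, the magic condition reads Y g (h - 1) + Y g h + Y g (h + 1) = k′ for all g and h.
-- Summing it over all mn vertices counts every label 3(2d + 1) times, so mn k′ = 3(2d + 1) mn(mn + 1)/2,
-- i.e. 2k′ = 3(2d + 1)(mn + 1), and mn is odd. The three-term relation makes h ↦ Y g h 3-periodic; being
-- n-periodic too, it is constant when 3 ∤ n. With x and y the label columns at h = 0 and h = 1, Y g 0 = Y g 1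
-- says x + A x = y + A y, so A (x - y) = -(x - y) with x ≠ y because the labelling is injective.
-- When 3 ∣ n instead, n odd gives n ≡ 3 (mod 6).

open import Defs hiding (sym)
open import Data.Bool using (Bool; true; false; if_then_else_; _∨_; _∧_)
open import Data.Bool.Properties using (∨-comm)
open import Data.Bool.Solver using (module ∨-∧-Solver)
open import Data.Fin using (Fin; toℕ; combine; remQuot; _↑ˡ_; _↑ʳ_) renaming (zero to fz; suc to fs)
open import Data.Fin.Permutation using (Permutation; _⟨$⟩ʳ_)
open import Data.Fin.Properties
  using (suc-injective; toℕ-injective; toℕ<n; toℕ-fromℕ<; remQuot-combine; *↔×) renaming (_≟_ to _≟F_)
open import Data.Nat using (ℕ; zero; suc; _+_; _*_; _%_; _/_; _≤_; _<_; z≤n; s≤s; NonZero)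
open import Data.Nat.Divisibility using (divides)
open import Data.Nat.DivMod
  using (_mod_; m%n<n; m<n⇒m%n≡m; m≡m%n+[m/n]*n; [m+n]%n≡m%n; m%n%n≡m%n; %-distribˡ-+; %-distribˡ-*; m∣n⇒o%n%m≡o%m)
import Data.Nat.Properties as ℕ
open import Data.Nat.Tactic.RingSolver using (solve-∀)
open import Data.Product using (_×_; _,_; proj₁; proj₂)
open import Data.Rational as ℚ using (ℚ; 0ℚ; 1ℚ)
import Data.Rational.Properties as ℚ
open import Data.Rational.Solver renaming (module +-*-Solver to ℚ-Solver)
open import Data.Sum using (_⊎_; inj₁; inj₂)
open import Function.Base using (_∘_)
open import Function.Bundles using (_⇔_; mk⇔; mk⤖)
open import Function.Construct.Composition using (_↔-∘_; _⇔-∘_)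
open import Function.Definitions using (Injective; Surjective)
open import Function.Properties.Bijection using (⤖⇒↔)
open import Relation.Binary.PropositionalEquality
open import Relation.Nullary using (Dec; yes; no; contradiction)
open import Relation.Nullary.Decidable using (⌊_⌋; isYes≗does; does-⇔; dec-false)
open import Algebra.Properties.Semiring.Sum ℕ.+-*-semiring
  using (sum; ∑-comm; ∑-distrib-+; *-distribˡ-sum; *-distribʳ-sum; sum-cong-≗; sum-permute)
open import Algebra.Properties.Monoid.Mult ℚ.+-0-monoid using (×-homo-+) renaming (_×_ to _·_)
open import Algebra.Properties.Group ℚ.+-0-group using (x∙y⁻¹≈ε⇒x≈y) renaming (∙-cancelˡ to +-cancelˡ)

-- Finite sums

⌊⌋-⇔ : ∀ {A B : Set} → A ⇔ B → (a? : Dec A) (b? : Dec B) → ⌊ a? ⌋ ≡ ⌊ b? ⌋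
⌊⌋-⇔ A⇔B a? b? = trans (isYes≗does a?) (trans (does-⇔ A⇔B a? b?) (sym (isYes≗does b?)))

==-sym : ∀ {n} (i j : Fin n) → (i == j) ≡ (j == i)
==-sym i j = ⌊⌋-⇔ (mk⇔ sym sym) (i ≟F j) (j ≟F i)

==-suc : ∀ {n} (i j : Fin n) → (fs i == fs j) ≡ (i == j)
==-suc i j = ⌊⌋-⇔ (mk⇔ suc-injective (cong fs)) (fs i ≟F fs j) (i ≟F j)

==-false : ∀ {n} {i j : Fin n} → i ≢ j → (i == j) ≡ false
==-false {i = i} {j} i≢j = trans (isYes≗does (i ≟F j)) (dec-false (i ≟F j) i≢j)

_when_ : ℕ → Bool → ℕ
x when b = if b then x else 0

infix 5 _when_

sumℕ-cong : ∀ n {f g : Fin n → ℕ} → (∀ i → f i ≡ g i) → sumℕ n f ≡ sumℕ n g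
sumℕ-cong zero    f≗g = refl
sumℕ-cong (suc n) f≗g = cong₂ _+_ (f≗g fz) (sumℕ-cong n (λ i → f≗g (fs i)))

sumℕ≡sum : ∀ n (f : Fin n → ℕ) → sumℕ n f ≡ sum f
sumℕ≡sum zero    f = refl
sumℕ≡sum (suc n) f = cong (f fz +_) (sumℕ≡sum n (λ i → f (fs i)))

sumℕ²≡sum² : ∀ m n (f : Fin m → Fin n → ℕ) →
  sumℕ m (λ i → sumℕ n (f i)) ≡ sum (λ i → sum (f i))
sumℕ²≡sum² m n f = trans (sumℕ≡sum m _) (sum-cong-≗ (λ i → sumℕ≡sum n (f i)))

sumℕ-zero : ∀ n → sumℕ n (λ _ → 0) ≡ 0
sumℕ-zero zero    = refl
sumℕ-zero (suc n) = sumℕ-zero n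

sumℕ-const : ∀ n c → sumℕ n (λ _ → c) ≡ n * c
sumℕ-const zero    c = refl
sumℕ-const (suc n) c = cong (c +_) (sumℕ-const n c)

sumℕ-distrib-+ : ∀ n (f g : Fin n → ℕ) → sumℕ n (λ i → f i + g i) ≡ sumℕ n f + sumℕ n g
sumℕ-distrib-+ n f g = begin
  sumℕ n (λ i → f i + g i) ≡⟨ sumℕ≡sum n _ ⟩
  sum (λ i → f i + g i)    ≡⟨ ∑-distrib-+ f g ⟩
  sum f + sum g            ≡⟨ sym (cong₂ _+_ (sumℕ≡sum n f) (sumℕ≡sum n g)) ⟩
  sumℕ n f + sumℕ n g      ∎
  where open ≡-Reasoning

sumℕ-comm : ∀ m n (f : Fin m → Fin n → ℕ) →
  sumℕ m (λ i → sumℕ n (f i)) ≡ sumℕ n (λ j → sumℕ m (λ i → f i j))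
sumℕ-comm m n f = begin
  sumℕ m (λ i → sumℕ n (f i))          ≡⟨ sumℕ²≡sum² m n f ⟩
  sum (λ i → sum (f i))                ≡⟨ ∑-comm f ⟩
  sum (λ j → sum (λ i → f i j))        ≡⟨ sym (sumℕ²≡sum² n m (λ j i → f i j)) ⟩
  sumℕ n (λ j → sumℕ m (λ i → f i j))  ∎
  where open ≡-Reasoning

*-distribˡ-sumℕ : ∀ n c (f : Fin n → ℕ) → c * sumℕ n f ≡ sumℕ n (λ i → c * f i)
*-distribˡ-sumℕ n c f = begin
  c * sumℕ n f             ≡⟨ cong (c *_) (sumℕ≡sum n f) ⟩
  c * sum f                ≡⟨ *-distribˡ-sum c f ⟩
  sum (λ i → c * f i)      ≡⟨ sym (sumℕ≡sum n _) ⟩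
  sumℕ n (λ i → c * f i)   ∎
  where open ≡-Reasoning

*-distribʳ-sumℕ : ∀ n c (f : Fin n → ℕ) → sumℕ n f * c ≡ sumℕ n (λ i → f i * c)
*-distribʳ-sumℕ n c f = begin
  sumℕ n f * c             ≡⟨ cong (_* c) (sumℕ≡sum n f) ⟩
  sum f * c                ≡⟨ *-distribʳ-sum c f ⟩
  sum (λ i → f i * c)      ≡⟨ sym (sumℕ≡sum n _) ⟩
  sumℕ n (λ i → f i * c)   ∎
  where open ≡-Reasoning

sumℕ-when : ∀ n b (f : Fin n → ℕ) → sumℕ n (λ i → f i when b) ≡ (sumℕ n f when b)
sumℕ-when n true  f = refl
sumℕ-when n false f = sumℕ-zero n

sumℕ-when-const : ∀ n (p : Fin n → Bool) c → sumℕ n (λ i → c when p i) ≡ sumℕ n (λ i → 1 when p i) * c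
sumℕ-when-const n p c = trans (sumℕ-cong n (λ i → when-1* (p i))) (sym (*-distribʳ-sumℕ n c _))
  where
  when-1* : ∀ b → (c when b) ≡ (1 when b) * c
  when-1* true  = sym (ℕ.*-identityˡ c)
  when-1* false = refl

sumℕ-when-== : ∀ n (i : Fin n) (f : Fin n → ℕ) → sumℕ n (λ j → f j when (j == i)) ≡ f i
sumℕ-when-== (suc n) fz     f = trans (cong (f fz +_) (sumℕ-zero n)) (ℕ.+-identityʳ (f fz))
sumℕ-when-== (suc n) (fs i) f =
  trans (sumℕ-cong n (λ j → cong (f (fs j) when_) (==-suc j i))) (sumℕ-when-== n i (λ j → f (fs j)))

sumℕ-when-∨ : ∀ n (p q : Fin n → Bool) (f : Fin n → ℕ) → (∀ i → p i ∧ q i ≡ false) →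
  sumℕ n (λ i → f i when (p i ∨ q i)) ≡ sumℕ n (λ i → f i when p i) + sumℕ n (λ i → f i when q i)
sumℕ-when-∨ n p q f disjoint =
  trans (sumℕ-cong n (λ i → when-∨ (p i) (q i) (f i) (disjoint i))) (sumℕ-distrib-+ n _ _)
  where
  when-∨ : ∀ a b x → a ∧ b ≡ false → (x when (a ∨ b)) ≡ (x when a) + (x when b)
  when-∨ true  false x _ = sym (ℕ.+-identityʳ x)
  when-∨ false b     x _ = refl

sumℕ-when-∧ : ∀ m n (p : Fin m → Bool) (q : Fin n → Bool) (f : Fin m → Fin n → ℕ) →
  sumℕ m (λ i → sumℕ n (λ j → f i j when (p i ∧ q j))) ≡ sumℕ n (λ j → sumℕ m (λ i → f i j when p i) when q j)
sumℕ-when-∧ m n p q f = trans (sumℕ-comm m n _) (sumℕ-cong n λ j →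
  trans (sumℕ-cong m (λ i → when-∧ (p i) (q j) (f i j))) (sumℕ-when m (q j) _))
  where
  when-∧ : ∀ a b x → (x when (a ∧ b)) ≡ ((x when a) when b)
  when-∧ true  b     x = refl
  when-∧ false true  x = refl
  when-∧ false false x = refl

sumℕ-permute : ∀ n (f : Fin n → ℕ) (π : Permutation n n) → sumℕ n f ≡ sumℕ n (λ i → f (π ⟨$⟩ʳ i))
sumℕ-permute n f π = begin
  sumℕ n f                      ≡⟨ sumℕ≡sum n f ⟩
  sum f                         ≡⟨ sum-permute f π ⟩
  sum (λ i → f (π ⟨$⟩ʳ i))      ≡⟨ sym (sumℕ≡sum n _) ⟩
  sumℕ n (λ i → f (π ⟨$⟩ʳ i))   ∎
  where open ≡-Reasoning

sumℕ-splitAt : ∀ a b (f : Fin (a + b) → ℕ) →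
  sumℕ (a + b) f ≡ sumℕ a (λ i → f (i ↑ˡ b)) + sumℕ b (λ j → f (a ↑ʳ j))
sumℕ-splitAt zero    b f = refl
sumℕ-splitAt (suc a) b f =
  trans (cong (f fz +_) (sumℕ-splitAt a b (λ i → f (fs i)))) (sym (ℕ.+-assoc (f fz) _ _))

sumℕ-combine : ∀ m n (f : Fin (m * n) → ℕ) → sumℕ (m * n) f ≡ sumℕ m (λ i → sumℕ n (λ j → f (combine i j)))
sumℕ-combine zero    n f = refl
sumℕ-combine (suc m) n f =
  trans (sumℕ-splitAt n (m * n) f) (cong (sumℕ n (λ j → f (j ↑ˡ m * n)) +_) (sumℕ-combine m n (λ k → f (n ↑ʳ k))))

sumℕ-bijection : ∀ m n (ℓ : Fin m × Fin n → Fin (m * n)) →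
  Injective _≡_ _≡_ ℓ → Surjective _≡_ _≡_ ℓ → ∀ (f : Fin (m * n) → ℕ) →
  sumℕ m (λ i → sumℕ n (λ j → f (ℓ (i , j)))) ≡ sumℕ (m * n) f
sumℕ-bijection m n ℓ injective surjective f = sym (begin
  sumℕ (m * n) f                                                ≡⟨ sumℕ-permute (m * n) f π ⟩
  sumℕ (m * n) (λ k → f (ℓ (remQuot n k)))                      ≡⟨ sumℕ-combine m n _ ⟩
  sumℕ m (λ i → sumℕ n (λ j → f (ℓ (remQuot n (combine i j)))))
    ≡⟨ sumℕ-cong m (λ i → sumℕ-cong n (λ j → cong (f ∘ ℓ) (remQuot-combine i j))) ⟩
  sumℕ m (λ i → sumℕ n (λ j → f (ℓ (i , j))))                   ∎)
  where
  open ≡-Reasoning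
  π : Permutation (m * n) (m * n)
  π = ⤖⇒↔ (mk⤖ (injective , surjective)) ↔-∘ *↔×

2*sumℕ-suc-toℕ : ∀ n → 2 * sumℕ n (λ i → suc (toℕ i)) ≡ n * suc n
2*sumℕ-suc-toℕ zero    = refl
2*sumℕ-suc-toℕ (suc n) = begin
  2 * (1 + sumℕ n (λ i → 1 + suc (toℕ i)))          ≡⟨ cong (λ s → 2 * (1 + s)) (sumℕ-distrib-+ n _ _) ⟩
  2 * (1 + (sumℕ n (λ _ → 1) + S))                  ≡⟨ cong (λ s → 2 * (1 + (s + S))) (sumℕ-const n 1) ⟩
  2 * (1 + (n * 1 + S))                             ≡⟨ arrange n S ⟩
  2 + 2 * n + 2 * S                                 ≡⟨ cong (2 + 2 * n +_) (2*sumℕ-suc-toℕ n) ⟩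
  2 + 2 * n + n * suc n                             ≡⟨ factor n ⟩
  suc n * suc (suc n)                               ∎
  where
  open ≡-Reasoning
  S : ℕ
  S = sumℕ n (λ i → suc (toℕ i))
  arrange : ∀ n S → 2 * (1 + (n * 1 + S)) ≡ 2 + 2 * n + 2 * S
  arrange = solve-∀
  factor : ∀ n → 2 + 2 * n + n * suc n ≡ suc n * suc (suc n)
  factor = solve-∀

-- Closed neighbourhoods

closedNbhd : ∀ {m} → Graph m → Fin m → Fin m → Bool
closedNbhd G v u = (u == v) ∨ adj G v u

adjSum : ∀ {m} → Graph m → (Fin m → ℕ) → Fin m → ℕ
adjSum {m} G x v = sumℕ m (λ u → x u when adj G v u)

closedNbhd-sym : ∀ {m} (G : Graph m) u v → closedNbhd G v u ≡ closedNbhd G u v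
closedNbhd-sym G u v = cong₂ _∨_ (==-sym u v) (Graph.sym G v u)

sumℕ-closedNbhd : ∀ {m} (G : Graph m) (x : Fin m → ℕ) v →
  sumℕ m (λ u → x u when closedNbhd G v u) ≡ x v + adjSum G x v
sumℕ-closedNbhd {m} G x v =
  trans (sumℕ-when-∨ m _ _ x disjoint) (cong (_+ adjSum G x v) (sumℕ-when-== m v x))
  where
  disjoint : ∀ u → (u == v) ∧ adj G v u ≡ false
  disjoint u with u ≟F v
  ... | yes refl = irrefl G v
  ... | no  _    = refl

closedNbhd-size : ∀ {m k} (G : Graph m) → Regular G k → ∀ u → sumℕ m (λ v → 1 when closedNbhd G v u) ≡ suc k
closedNbhd-size {m} G regular u =
  trans (sumℕ-cong m (λ v → cong (1 when_) (closedNbhd-sym G u v)))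
        (trans (sumℕ-closedNbhd G (λ _ → 1) u) (cong suc (regular u)))

sumℕ-closedNbhds : ∀ {m k} (G : Graph m) → Regular G k → ∀ (x : Fin m → ℕ) →
  sumℕ m (λ v → sumℕ m (λ u → x u when closedNbhd G v u)) ≡ suc k * sumℕ m x
sumℕ-closedNbhds {m} {k} G regular x = begin
  sumℕ m (λ v → sumℕ m (λ u → x u when closedNbhd G v u))  ≡⟨ sumℕ-comm m m _ ⟩
  sumℕ m (λ u → sumℕ m (λ v → x u when closedNbhd G v u))
    ≡⟨ sumℕ-cong m (λ u → sumℕ-when-const m (λ v → closedNbhd G v u) (x u)) ⟩
  sumℕ m (λ u → sumℕ m (λ v → 1 when closedNbhd G v u) * x u)
    ≡⟨ sumℕ-cong m (λ u → cong (_* x u) (closedNbhd-size G regular u)) ⟩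
  sumℕ m (λ u → suc k * x u)                               ≡⟨ sym (*-distribˡ-sumℕ m (suc k) x) ⟩
  suc k * sumℕ m x                                         ∎
  where open ≡-Reasoning

strongProduct-closedNbhd : ∀ {m} (G : Graph m) n g₀ h₀ g h →
  ((g == g₀ ∧ h == h₀) ∨ strongAdj G n (g₀ , h₀) (g , h)) ≡
  (closedNbhd G g₀ g ∧ ((h == h₀) ∨ cycleAdj n h₀ h))
strongProduct-closedNbhd G n g₀ h₀ g h =
  trans (cong₂ (λ x y → (a ∧ b) ∨ ((x ∧ c) ∨ ((y ∧ e) ∨ (e ∧ c)))) (==-sym g₀ g) (==-sym h₀ h))
        (solve 4 (λ a b c e → (a :* b) :+ ((a :* c) :+ ((b :* e) :+ (e :* c))) := (a :+ e) :* (b :+ c)) refl a b c e)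
  where
  open ∨-∧-Solver
  a b c e : Bool
  a = g == g₀
  b = h == h₀
  c = cycleAdj n h₀ h
  e = adj G g₀ g

-- The cycle C_n

[m+n%o]%o≡[m+n]%o : ∀ m n o .{{_ : NonZero o}} → (m + n % o) % o ≡ (m + n) % o
[m+n%o]%o≡[m+n]%o m n o = begin
  (m + n % o) % o          ≡⟨ %-distribˡ-+ m (n % o) o ⟩
  (m % o + n % o % o) % o  ≡⟨ cong (λ x → (m % o + x) % o) (m%n%n≡m%n n o) ⟩
  (m % o + n % o) % o      ≡⟨ sym (%-distribˡ-+ m n o) ⟩
  (m + n) % o              ∎
  where open ≡-Reasoning

[m+n]%o≢n : ∀ {m o} n .{{_ : NonZero o}} → 0 < m → m < o → (m + n) % o ≢ n
[m+n]%o≢n {m} {o} n 0<m m<o [m+n]%o≡n = notMultiple ((m + n) / o) m≡q*o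
  where
  open ≡-Reasoning
  m≡q*o : m ≡ (m + n) / o * o
  m≡q*o = ℕ.+-cancelˡ-≡ n _ _ (begin
    n + m                          ≡⟨ ℕ.+-comm n m ⟩
    m + n                          ≡⟨ m≡m%n+[m/n]*n (m + n) o ⟩
    (m + n) % o + (m + n) / o * o  ≡⟨ cong (_+ (m + n) / o * o) [m+n]%o≡n ⟩
    n + (m + n) / o * o            ∎)
  notMultiple : ∀ q → m ≢ q * o
  notMultiple zero    m≡0   = ℕ.<⇒≢ 0<m (sym m≡0)
  notMultiple (suc q) m≡q*o = ℕ.<⇒≱ m<o (subst (o ≤_) (sym m≡q*o) (ℕ.m≤m+n o (q * o)))

module Cyclic (n′ : ℕ) where

  at : ℕ → Fin (suc n′)
  at i = i mod suc n′

  toℕ-at : ∀ i → toℕ (at i) ≡ i % suc n′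
  toℕ-at i = toℕ-fromℕ< (m%n<n i (suc n′))

  at-cong : ∀ i j → i % suc n′ ≡ j % suc n′ → at i ≡ at j
  at-cong i j i≡j = toℕ-injective (trans (toℕ-at i) (trans i≡j (sym (toℕ-at j))))

  at-toℕ : ∀ h → at (toℕ h) ≡ h
  at-toℕ h = toℕ-injective (trans (toℕ-at (toℕ h)) (m<n⇒m%n≡m (toℕ<n h)))

  at-+-period : ∀ i → at (suc n′ + i) ≡ at i
  at-+-period i = at-cong (suc n′ + i) i (trans (cong (_% suc n′) (ℕ.+-comm (suc n′) i)) ([m+n]%n≡m%n i (suc n′)))

  succ pred : Fin (suc n′) → Fin (suc n′)
  succ h = at (suc (toℕ h))
  pred h = at (toℕ h + n′)   -- not toℕ h ∸ 1, which would fix the vertex 0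

  succ-at : ∀ i → succ (at i) ≡ at (suc i)
  succ-at i = at-cong (suc (toℕ (at i))) (suc i)
    (trans (cong (λ x → suc x % suc n′) (toℕ-at i)) ([m+n%o]%o≡[m+n]%o 1 i (suc n′)))

  pred-at : ∀ i → pred (at (suc i)) ≡ at i
  pred-at i = at-cong (toℕ (at (suc i)) + n′) i (begin
    (toℕ (at (suc i)) + n′) % N  ≡⟨ cong (λ x → (x + n′) % N) (toℕ-at (suc i)) ⟩
    (suc i % N + n′) % N         ≡⟨ cong (_% N) (ℕ.+-comm (suc i % N) n′) ⟩
    (n′ + suc i % N) % N         ≡⟨ [m+n%o]%o≡[m+n]%o n′ (suc i) N ⟩
    (n′ + suc i) % N             ≡⟨ cong (_% N) (trans (ℕ.+-suc n′ i) (ℕ.+-comm (suc n′) i)) ⟩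
    (i + N) % N                  ≡⟨ [m+n]%n≡m%n i N ⟩
    i % N                        ∎)
    where
    open ≡-Reasoning
    N : ℕ
    N = suc n′

  pred-succ : ∀ h → pred (succ h) ≡ h
  pred-succ h = trans (pred-at (toℕ h)) (at-toℕ h)

  succ-pred : ∀ h → succ (pred h) ≡ h
  succ-pred h = trans (succ-at (toℕ h + n′)) (trans (at-cong (suc (toℕ h + n′)) (toℕ h) h+n≡h) (at-toℕ h))
    where
    h+n≡h : suc (toℕ h + n′) % suc n′ ≡ toℕ h % suc n′
    h+n≡h = trans (cong (_% suc n′) (sym (ℕ.+-suc (toℕ h) n′))) ([m+n]%n≡m%n (toℕ h) (suc n′))

  at-+-≢ : ∀ {k} h → 0 < k → k < suc n′ → at (k + toℕ h) ≢ h
  at-+-≢ {k} h 0<k k<n e = [m+n]%o≢n (toℕ h) 0<k k<n (trans (sym (toℕ-at (k + toℕ h))) (cong toℕ e))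

  succ-≢ : 1 ≤ n′ → ∀ h → succ h ≢ h
  succ-≢ 1≤n′ h = at-+-≢ h (s≤s z≤n) (s≤s 1≤n′)

  pred-≢ : 1 ≤ n′ → ∀ h → pred h ≢ h
  pred-≢ 1≤n′ h pred≡ = succ-≢ 1≤n′ h (trans (cong succ (sym pred≡)) (succ-pred h))

  succ-≢-pred : 2 ≤ n′ → ∀ h → succ h ≢ pred h
  succ-≢-pred 2≤n′ h succ≡pred =
    at-+-≢ h (s≤s z≤n) (s≤s 2≤n′) (trans (sym (succ-at (suc (toℕ h)))) (trans (cong succ succ≡pred) (succ-pred h)))

  ≡-succ⇔≡-pred : ∀ h₀ h → h₀ ≡ succ h ⇔ h ≡ pred h₀
  ≡-succ⇔≡-pred h₀ h = mk⇔ (λ e → trans (sym (pred-succ h)) (cong pred (sym e)))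
                           (λ e → trans (sym (succ-pred h₀)) (cong succ (sym e)))

  toℕ≡⇔≡succ : ∀ h₀ h → toℕ h ≡ suc (toℕ h₀) % suc n′ ⇔ h ≡ succ h₀
  toℕ≡⇔≡succ h₀ h = mk⇔ (λ e → toℕ-injective (trans e (sym (toℕ-at (suc (toℕ h₀))))))
                        (λ e → trans (cong toℕ e) (toℕ-at (suc (toℕ h₀))))

  cycleAdj-succ-pred : ∀ h₀ h → cycleAdj (suc n′) h₀ h ≡ (h == succ h₀) ∨ (h == pred h₀)
  cycleAdj-succ-pred h₀ h = cong₂ _∨_
    (⌊⌋-⇔ (toℕ≡⇔≡succ h₀ h) (toℕ h ℕ.≟ suc (toℕ h₀) % suc n′) (h ≟F succ h₀))
    (⌊⌋-⇔ (≡-succ⇔≡-pred h₀ h ⇔-∘ toℕ≡⇔≡succ h h₀)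
          (toℕ h₀ ℕ.≟ suc (toℕ h) % suc n′) (h ≟F pred h₀))

module CycleGraph (k : ℕ) where

  open Cyclic (2 + k) public

  cycle : Graph (3 + k)
  cycle = record
    { adj    = cycleAdj (3 + k)
    ; sym    = λ u v → ∨-comm ⌊ toℕ v ℕ.≟ suc (toℕ u) % (3 + k) ⌋ ⌊ toℕ u ℕ.≟ suc (toℕ v) % (3 + k) ⌋
    ; irrefl = λ v → trans (cycleAdj-succ-pred v v)
                           (cong₂ _∨_ (==-false (succ-≢ (s≤s z≤n) v ∘ sym)) (==-false (pred-≢ (s≤s z≤n) v ∘ sym)))
    }

  cycle-adjSum : ∀ (f : Fin (3 + k) → ℕ) h₀ → adjSum cycle f h₀ ≡ f (succ h₀) + f (pred h₀)
  cycle-adjSum f h₀ = begin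
    sumℕ (3 + k) (λ h → f h when cycleAdj (3 + k) h₀ h)
      ≡⟨ sumℕ-cong (3 + k) (λ h → cong (f h when_) (cycleAdj-succ-pred h₀ h)) ⟩
    sumℕ (3 + k) (λ h → f h when ((h == succ h₀) ∨ (h == pred h₀)))
      ≡⟨ sumℕ-when-∨ (3 + k) (_== succ h₀) (_== pred h₀) f disjoint ⟩
    sumℕ (3 + k) (λ h → f h when (h == succ h₀)) + sumℕ (3 + k) (λ h → f h when (h == pred h₀))
      ≡⟨ cong₂ _+_ (sumℕ-when-== (3 + k) (succ h₀) f) (sumℕ-when-== (3 + k) (pred h₀) f) ⟩
    f (succ h₀) + f (pred h₀)
      ∎
    where
    open ≡-Reasoning
    disjoint : ∀ h → (h == succ h₀) ∧ (h == pred h₀) ≡ false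
    disjoint h with h ≟F succ h₀
    ... | yes refl = ==-false (succ-≢-pred (s≤s (s≤s z≤n)) h₀)
    ... | no  _    = refl

  cycle-regular : Regular cycle 2
  cycle-regular = cycle-adjSum (λ _ → 1)

-- Periodicity and parity

3-periodic : ∀ (W : ℕ → ℕ) {c} → (∀ i → W (1 + i) + (W (2 + i) + W i) ≡ c) → ∀ q i → W (q * 3 + i) ≡ W i
3-periodic W sums zero    i = refl
3-periodic W {c} sums (suc q) i = trans (shift3 (q * 3 + i)) (3-periodic W sums q i)
  where
  rotate : ∀ a b d → a + b + d ≡ b + (d + a)
  rotate = solve-∀
  shift3 : ∀ i → W (3 + i) ≡ W i
  shift3 i = ℕ.+-cancelˡ-≡ (W (1 + i) + W (2 + i)) _ _ (begin
    W (1 + i) + W (2 + i) + W (3 + i)    ≡⟨ rotate (W (1 + i)) (W (2 + i)) (W (3 + i)) ⟩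
    W (2 + i) + (W (3 + i) + W (1 + i))  ≡⟨ sums (1 + i) ⟩
    c                                    ≡⟨ sym (sums i) ⟩
    W (1 + i) + (W (2 + i) + W i)        ≡⟨ sym (ℕ.+-assoc (W (1 + i)) (W (2 + i)) (W i)) ⟩
    W (1 + i) + W (2 + i) + W i          ∎)
    where open ≡-Reasoning

periodic-3∧n⇒W₀≡W₁ : ∀ (W : ℕ → ℕ) n → (∀ q i → W (q * 3 + i) ≡ W i) → (∀ i → W (n + i) ≡ W i) →
  n % 3 ≢ 0 → W 0 ≡ W 1
periodic-3∧n⇒W₀≡W₁ W n period3 periodN n%3≢0 with n % 3 | m%n<n n 3 | m≡m%n+[m/n]*n n 3
... | 0 | _ | _  = contradiction refl n%3≢0
... | 1 | _ | n≡ = begin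
  W 0                  ≡⟨ sym (periodN 0) ⟩
  W (n + 0)            ≡⟨ cong W (trans (ℕ.+-identityʳ n) (trans n≡ (ℕ.+-comm 1 (n / 3 * 3)))) ⟩
  W (n / 3 * 3 + 1)    ≡⟨ period3 (n / 3) 1 ⟩
  W 1                  ∎
  where open ≡-Reasoning
... | 2 | _ | n≡ = begin
  W 0                    ≡⟨ sym (period3 (suc (n / 3)) 0) ⟩
  W (suc (n / 3) * 3 + 0) ≡⟨ cong W (trans (shift (n / 3)) (cong (_+ 1) (sym n≡))) ⟩
  W (n + 1)              ≡⟨ periodN 1 ⟩
  W 1                    ∎
  where
  open ≡-Reasoning
  shift : ∀ q → suc q * 3 + 0 ≡ 2 + q * 3 + 1
  shift = solve-∀
... | suc (suc (suc _)) | s≤s (s≤s (s≤s ())) | _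

2*c≡odd*[1+N]⇒N%2≡1 : ∀ c a N → 2 * c ≡ suc (2 * a) * suc N → N % 2 ≡ 1
2*c≡odd*[1+N]⇒N%2≡1 c a N eq with N % 2 | m%n<n N 2 | m≡m%n+[m/n]*n N 2
... | 1           | _            | _  = refl
... | 0           | _            | N≡ = contradiction
  (trans eq (trans (cong (λ x → suc (2 * a) * suc x) N≡) (expand a (N / 2))))
  (ℕ.even≢odd c (a + N / 2 + 2 * a * (N / 2)))
  where
  expand : ∀ a q → suc (2 * a) * suc (q * 2) ≡ suc (2 * (a + q + 2 * a * q))
  expand = solve-∀
... | suc (suc _) | s≤s (s≤s ()) | _

%2≡1-*⁻¹ : ∀ a b → (a * b) % 2 ≡ 1 → a % 2 ≡ 1 × b % 2 ≡ 1
%2≡1-*⁻¹ a b odd = bothOne (a % 2) (b % 2) (m%n<n a 2) (m%n<n b 2) (trans (sym (%-distribˡ-* a b 2)) odd)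
  where
  bothOne : ∀ r s → r < 2 → s < 2 → (r * s) % 2 ≡ 1 → r ≡ 1 × s ≡ 1
  bothOne 1 1 _ _ _ = refl , refl
  bothOne 0 _ _ _ ()
  bothOne 1 0 _ _ ()
  bothOne (suc (suc _)) _ (s≤s (s≤s ())) _ _
  bothOne 1 (suc (suc _)) _ (s≤s (s≤s ())) _

%2≡1∧%3≡0⇒%6≡3 : ∀ n → n % 2 ≡ 1 → n % 3 ≡ 0 → n % 6 ≡ 3
%2≡1∧%3≡0⇒%6≡3 n odd 3∣n = residue (n % 6) (m%n<n n 6)
  (trans (m∣n⇒o%n%m≡o%m 2 6 n (divides 3 refl)) odd) (trans (m∣n⇒o%n%m≡o%m 3 6 n (divides 2 refl)) 3∣n)
  where
  residue : ∀ r → r < 6 → r % 2 ≡ 1 → r % 3 ≡ 0 → r ≡ 3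
  residue 3 _ _ _ = refl
  residue 0 _ () _
  residue 1 _ _ ()
  residue 2 _ () _
  residue 4 _ () _
  residue 5 _ _ ()
  residue (suc (suc (suc (suc (suc (suc _)))))) (s≤s (s≤s (s≤s (s≤s (s≤s (s≤s ())))))) _ _

double-count⇒odd : ∀ N d k′ R .{{_ : NonZero N}} → N * k′ ≡ 3 * (suc (2 * d) * R) → 2 * R ≡ N * suc N → N % 2 ≡ 1
double-count⇒odd N d k′ R count twiceR = 2*c≡odd*[1+N]⇒N%2≡1 k′ (3 * d + 1) N (ℕ.*-cancelˡ-≡ _ _ N (begin
  N * (2 * k′)                         ≡⟨ swap N k′ ⟩
  2 * (N * k′)                         ≡⟨ cong (2 *_) count ⟩
  2 * (3 * (suc (2 * d) * R))          ≡⟨ odd-3 d R ⟩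
  suc (2 * (3 * d + 1)) * (2 * R)      ≡⟨ cong (suc (2 * (3 * d + 1)) *_) twiceR ⟩
  suc (2 * (3 * d + 1)) * (N * suc N)  ≡⟨ swap′ (suc (2 * (3 * d + 1))) N ⟩
  N * (suc (2 * (3 * d + 1)) * suc N)  ∎))
  where
  open ≡-Reasoning
  swap : ∀ N k → N * (2 * k) ≡ 2 * (N * k)
  swap = solve-∀
  odd-3 : ∀ d R → 2 * (3 * (suc (2 * d) * R)) ≡ suc (2 * (3 * d + 1)) * (2 * R)
  odd-3 = solve-∀
  swap′ : ∀ a N → a * (N * suc N) ≡ N * (a * suc N)
  swap′ = solve-∀

-- The eigenvalue −1

toℚ : ℕ → ℚ
toℚ n = n · 1ℚ

toℚ-+ : ∀ a b → toℚ (a + b) ≡ toℚ a ℚ.+ toℚ b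
toℚ-+ a b = ×-homo-+ 1ℚ a b

toℚ-nonNegative : ∀ n → 0ℚ ℚ.≤ toℚ n
toℚ-nonNegative zero    = ℚ.≤-refl
toℚ-nonNegative (suc n) = ℚ.+-mono-≤ (ℚ.nonNegative⁻¹ 1ℚ) (toℚ-nonNegative n)

toℚ-suc-positive : ∀ n → 0ℚ ℚ.< toℚ (suc n)
toℚ-suc-positive n = ℚ.+-mono-<-≤ (ℚ.positive⁻¹ 1ℚ) (toℚ-nonNegative n)

toℚ-injective : ∀ a b → toℚ a ≡ toℚ b → a ≡ b
toℚ-injective zero    zero    _ = refl
toℚ-injective zero    (suc b) e = contradiction e (ℚ.<⇒≢ (toℚ-suc-positive b))
toℚ-injective (suc a) zero    e = contradiction (sym e) (ℚ.<⇒≢ (toℚ-suc-positive a))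
toℚ-injective (suc a) (suc b) e = cong suc (toℚ-injective a b (+-cancelˡ 1ℚ (toℚ a) (toℚ b) e))

sumℚ-toℚ : ∀ m (p : Fin m → Bool) (x : Fin m → ℕ) →
  sumℚ m (λ j → (if p j then 1ℚ else 0ℚ) ℚ.* toℚ (x j)) ≡ toℚ (sumℕ m (λ j → x j when p j))
sumℚ-toℚ zero    p x = refl
sumℚ-toℚ (suc m) p x with p fz
... | true  = trans (cong₂ ℚ._+_ (ℚ.*-identityˡ (toℚ (x fz))) (sumℚ-toℚ m (p ∘ fs) (x ∘ fs)))
                    (sym (toℚ-+ (x fz) _))
... | false = trans (cong₂ ℚ._+_ (ℚ.*-zeroˡ (toℚ (x fz))) (sumℚ-toℚ m (p ∘ fs) (x ∘ fs)))
                    (ℚ.+-identityˡ _)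

sumℚ-*-distribˡ-minus : ∀ m (w u v : Fin m → ℚ) →
  sumℚ m (λ j → w j ℚ.* (u j ℚ.- v j)) ≡ sumℚ m (λ j → w j ℚ.* u j) ℚ.- sumℚ m (λ j → w j ℚ.* v j)
sumℚ-*-distribˡ-minus zero    w u v = refl
sumℚ-*-distribˡ-minus (suc m) w u v =
  trans (cong (w fz ℚ.* (u fz ℚ.- v fz) ℚ.+_) (sumℚ-*-distribˡ-minus m (w ∘ fs) (u ∘ fs) (v ∘ fs)))
        (solve 5 (λ w u v U V → w :* (u :- v) :+ (U :- V) := (w :* u :+ U) :- (w :* v :+ V)) refl
               (w fz) (u fz) (v fz) (sumℚ m (λ j → w (fs j) ℚ.* u (fs j))) (sumℚ m (λ j → w (fs j) ℚ.* v (fs j))))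
  where open ℚ-Solver

a+b≡c+d⇒b-d≡-[a-c] : ∀ {a b c d : ℚ} → a ℚ.+ b ≡ c ℚ.+ d → b ℚ.- d ≡ (ℚ.- 1ℚ) ℚ.* (a ℚ.- c)
a+b≡c+d⇒b-d≡-[a-c] {a} {b} {c} {d} eq = begin
  b ℚ.- d                                               ≡⟨ regroup a b c d ⟩
  ((a ℚ.+ b) ℚ.- (c ℚ.+ d)) ℚ.+ (ℚ.- 1ℚ) ℚ.* (a ℚ.- c)  ≡⟨ cong (λ s → (s ℚ.- (c ℚ.+ d)) ℚ.+ _) eq ⟩
  ((c ℚ.+ d) ℚ.- (c ℚ.+ d)) ℚ.+ (ℚ.- 1ℚ) ℚ.* (a ℚ.- c)  ≡⟨ cancel (c ℚ.+ d) _ ⟩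
  (ℚ.- 1ℚ) ℚ.* (a ℚ.- c)                                ∎
  where
  open ≡-Reasoning
  open ℚ-Solver
  regroup : ∀ a b c d → b ℚ.- d ≡ ((a ℚ.+ b) ℚ.- (c ℚ.+ d)) ℚ.+ (ℚ.- 1ℚ) ℚ.* (a ℚ.- c)
  regroup = solve 4 (λ a b c d → b :- d := ((a :+ b) :- (c :+ d)) :+ (:- con 1ℚ) :* (a :- c)) refl
  cancel : ∀ s t → (s ℚ.- s) ℚ.+ t ≡ t
  cancel = solve 2 (λ s t → (s :- s) :+ t := t) refl

minusOne∈Sp : ∀ {m} (G : Graph m) (x y : Fin m → ℕ) →
  (∀ i → x i + adjSum G x i ≡ y i + adjSum G y i) → ∀ i → x i ≢ y i → MinusOneInSpectrum G
minusOne∈Sp {m} G x y balanced i x≢y = z , (i , z≢0) , eigen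
  where
  z : Fin m → ℚ
  z j = toℚ (x j) ℚ.- toℚ (y j)
  z≢0 : z i ≢ 0ℚ
  z≢0 zi≡0 = x≢y (toℚ-injective (x i) (y i) (x∙y⁻¹≈ε⇒x≈y (toℚ (x i)) (toℚ (y i)) zi≡0))
  balancedℚ : ∀ j → toℚ (x j) ℚ.+ toℚ (adjSum G x j) ≡ toℚ (y j) ℚ.+ toℚ (adjSum G y j)
  balancedℚ j = trans (sym (toℚ-+ (x j) _)) (trans (cong toℚ (balanced j)) (toℚ-+ (y j) _))
  eigen : ∀ j → sumℚ m (λ u → adjMatrix G j u ℚ.* z u) ≡ (ℚ.- 1ℚ) ℚ.* z j
  eigen j = begin
    sumℚ m (λ u → adjMatrix G j u ℚ.* z u)
      ≡⟨ sumℚ-*-distribˡ-minus m (adjMatrix G j) (toℚ ∘ x) (toℚ ∘ y) ⟩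
    sumℚ m (λ u → adjMatrix G j u ℚ.* toℚ (x u)) ℚ.- sumℚ m (λ u → adjMatrix G j u ℚ.* toℚ (y u))
      ≡⟨ cong₂ ℚ._-_ (sumℚ-toℚ m (adj G j) x) (sumℚ-toℚ m (adj G j) y) ⟩
    toℚ (adjSum G x j) ℚ.- toℚ (adjSum G y j)
      ≡⟨ a+b≡c+d⇒b-d≡-[a-c] {toℚ (x j)} {_} {toℚ (y j)} (balancedℚ j) ⟩
    (ℚ.- 1ℚ) ℚ.* z j
      ∎
    where open ≡-Reasoning

-- Closed distance magic labellings of G ⊠ C_n

module MagicLabelling {m d k : ℕ} (G : Graph m) (regular : Regular G (2 * d))
                      (magic : ClosedDistanceMagicStrong G (3 + k)) where

  open CycleGraph k

  n : ℕ
  n = 3 + k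

  ℓ : Fin m × Fin n → Fin (m * n)
  ℓ = proj₁ magic

  k′ : ℕ
  k′ = proj₁ (proj₂ (proj₂ (proj₂ magic)))

  ℓ-injective : Injective _≡_ _≡_ ℓ
  ℓ-injective = proj₁ (proj₂ magic)

  ℓ-surjective : Surjective _≡_ _≡_ ℓ
  ℓ-surjective = proj₁ (proj₂ (proj₂ magic))

  L : Fin m → Fin n → ℕ
  L g h = suc (toℕ (ℓ (g , h)))

  closedNbhdSums : ∀ g₀ h₀ →
    sumℕ m (λ g → sumℕ n (λ h → L g h when ((g == g₀ ∧ h == h₀) ∨ strongAdj G n (g₀ , h₀) (g , h)))) ≡ k′
  closedNbhdSums g₀ h₀ = proj₂ (proj₂ (proj₂ (proj₂ (proj₂ magic)))) (g₀ , h₀)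

  column : Fin n → Fin m → ℕ
  column h g = L g h

  Y : Fin m → Fin n → ℕ
  Y g₀ h = sumℕ m (λ g → column h g when closedNbhd G g₀ g)

  Y-closedNbhdSum : ∀ g₀ h₀ → sumℕ n (λ h → Y g₀ h when closedNbhd cycle h₀ h) ≡ k′
  Y-closedNbhdSum g₀ h₀ = begin
    sumℕ n (λ h → Y g₀ h when closedNbhd cycle h₀ h)
      ≡⟨ sumℕ-when-∧ m n (closedNbhd G g₀) (closedNbhd cycle h₀) L ⟨
    sumℕ m (λ g → sumℕ n (λ h → L g h when (closedNbhd G g₀ g ∧ closedNbhd cycle h₀ h)))
      ≡⟨ sumℕ-cong m (λ g → sumℕ-cong n (λ h → cong (L g h when_) (strongProduct-closedNbhd G n g₀ h₀ g h))) ⟨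
    sumℕ m (λ g → sumℕ n (λ h → L g h when ((g == g₀ ∧ h == h₀) ∨ strongAdj G n (g₀ , h₀) (g , h))))
      ≡⟨ closedNbhdSums g₀ h₀ ⟩
    k′ ∎
    where open ≡-Reasoning

  Y-closedNbhdSum-succ-pred : ∀ g₀ h₀ → Y g₀ h₀ + (Y g₀ (succ h₀) + Y g₀ (pred h₀)) ≡ k′
  Y-closedNbhdSum-succ-pred g₀ h₀ = trans (sym (trans (sumℕ-closedNbhd cycle (Y g₀) h₀)
                                                      (cong (Y g₀ h₀ +_) (cycle-adjSum (Y g₀) h₀))))
                                          (Y-closedNbhdSum g₀ h₀)

  Y₀≡Y₁ : n % 3 ≢ 0 → ∀ g₀ → Y g₀ fz ≡ Y g₀ (fs fz)
  Y₀≡Y₁ n%3≢0 g₀ = periodic-3∧n⇒W₀≡W₁ W n (3-periodic W sums) (λ i → cong (Y g₀) (at-+-period i)) n%3≢0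
    where
    W : ℕ → ℕ
    W i = Y g₀ (at i)
    sums : ∀ i → W (1 + i) + (W (2 + i) + W i) ≡ k′
    sums i = trans (cong₂ (λ a b → W (1 + i) + (Y g₀ a + Y g₀ b)) (sym (succ-at (1 + i))) (sym (pred-at i)))
                   (Y-closedNbhdSum-succ-pred g₀ (at (1 + i)))

  minusOneInSpectrum : n % 3 ≢ 0 → Fin m → MinusOneInSpectrum G
  minusOneInSpectrum n%3≢0 g = minusOne∈Sp G (column fz) (column (fs fz)) balanced g L₀≢L₁
    where
    balanced : ∀ u → column fz u + adjSum G (column fz) u ≡ column (fs fz) u + adjSum G (column (fs fz)) u
    balanced u = trans (sym (sumℕ-closedNbhd G (column fz) u))
                       (trans (Y₀≡Y₁ n%3≢0 u) (sumℕ-closedNbhd G (column (fs fz)) u))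
    0≢1 : fz {2 + k} ≢ fs fz
    0≢1 ()
    L₀≢L₁ : L g fz ≢ L g (fs fz)
    L₀≢L₁ e = 0≢1 (cong proj₂ (ℓ-injective (toℕ-injective (ℕ.suc-injective e))))

  R : ℕ
  R = sumℕ m (λ g → sumℕ n (L g))

  twiceR : 2 * R ≡ (m * n) * suc (m * n)
  twiceR = trans (cong (2 *_) (sumℕ-bijection m n ℓ ℓ-injective ℓ-surjective (suc ∘ toℕ)))
                 (2*sumℕ-suc-toℕ (m * n))

  count : (m * n) * k′ ≡ 3 * (suc (2 * d) * R)
  count = begin
    m * n * k′
      ≡⟨ ℕ.*-assoc m n k′ ⟩
    m * (n * k′)
      ≡⟨ trans (sumℕ-cong m (λ _ → sumℕ-const n k′)) (sumℕ-const m (n * k′)) ⟨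
    sumℕ m (λ _ → sumℕ n (λ _ → k′))
      ≡⟨ sumℕ-cong m (λ g₀ → sumℕ-cong n (λ h₀ → Y-closedNbhdSum g₀ h₀)) ⟨
    sumℕ m (λ g₀ → sumℕ n (λ h₀ → sumℕ n (λ h → Y g₀ h when closedNbhd cycle h₀ h)))
      ≡⟨ sumℕ-cong m (λ g₀ → sumℕ-closedNbhds cycle cycle-regular (Y g₀)) ⟩
    sumℕ m (λ g₀ → 3 * sumℕ n (Y g₀))
      ≡⟨ trans (sym (*-distribˡ-sumℕ m 3 (λ g₀ → sumℕ n (Y g₀)))) (cong (3 *_) (sumℕ-comm m n Y)) ⟩
    3 * sumℕ n (λ h → sumℕ m (λ g₀ → Y g₀ h))
      ≡⟨ cong (3 *_) (sumℕ-cong n (λ h → sumℕ-closedNbhds G regular (column h))) ⟩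
    3 * sumℕ n (λ h → suc (2 * d) * sumℕ m (column h))
      ≡⟨ cong (3 *_) (*-distribˡ-sumℕ n (suc (2 * d)) (λ h → sumℕ m (column h))) ⟨
    3 * (suc (2 * d) * sumℕ n (λ h → sumℕ m (column h)))
      ≡⟨ cong (λ s → 3 * (suc (2 * d) * s)) (sumℕ-comm n m (λ h g → L g h)) ⟩
    3 * (suc (2 * d) * R)
      ∎
    where open ≡-Reasoning

mainTheorem12 : (m d n : ℕ) (G : Graph m) →
    1 ≤ m → Regular G (2 * d) → 3 ≤ n →
    ClosedDistanceMagicStrong G n →
    (n % 2 ≡ 1 × m % 2 ≡ 1) × (n % 6 ≡ 3 ⊎ MinusOneInSpectrum G)
mainTheorem12 (suc m′) d (suc (suc (suc k))) G (s≤s z≤n) regular (s≤s (s≤s (s≤s z≤n))) magic =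
  (proj₂ m,n-odd , proj₁ m,n-odd) , n%6≡3⊎-1∈Sp
  where
  open MagicLabelling {d = d} G regular magic
  m,n-odd : suc m′ % 2 ≡ 1 × n % 2 ≡ 1
  m,n-odd = %2≡1-*⁻¹ (suc m′) n (double-count⇒odd (suc m′ * n) d k′ R count twiceR)
  n%6≡3⊎-1∈Sp : n % 6 ≡ 3 ⊎ MinusOneInSpectrum G
  n%6≡3⊎-1∈Sp with n % 3 ℕ.≟ 0
  ... | yes n%3≡0 = inj₁ (%2≡1∧%3≡0⇒%6≡3 n (proj₂ m,n-odd) n%3≡0)
  ... | no  n%3≢0 = inj₂ (minusOneInSpectrum n%3≢0 fz)
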